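{- The fundamental group of the circle is equivalent to the integers: $\Pi_1(S^1,base)\simeq\mathbb{Z}$, via mutually inverse maps sending the class of $loop^n$ to $n$ and $n$ to the class of $loop^n$.
   Context: The circle $S^1$ is the higher inductive type generated by a point $base : S^1$ and a computational path $base =_{loop} base : S^1$. Computational paths are syntactic terms built using reflexivity $\rho$, symmetry $\sigma$ (from $a=_r b$ infer $b=_{\sigma(r)} a$) and transitivity $\tau$ (from $a=_r b$, $b=_s c$ infer $a=_{\tau(r,s)}c$). $\Pi_1(S^1,base) = \{[l]_{rw}\mid base =_l base : S^1\}$ is the set of $rw$-equivalence classes of loops at $base$, with group operation $r\circ s := \tau(s,r)$. Powers: $loop^0:=\rho$, $loop^n := loop^{n-1}\circ loop$ and $loop^{ -n} := loop^{ -(n-1)}\circ\sigma(loop)$ for $n>0$. Two paths are $rw$-equal if one can be obtained from the other by finitely many applications (and reverse applications) of the rewrite rules of the system $LND_{EQ}$-$TRS$, which include $\tau(r,\sigma(r))\rhd\rho$, $\tau(\sigma(r),r)\rhd\rho$, $\tau(r,\rho)\rhd r$, $\tau(\rho,r)\rhd r$, $\tau(\tau(t,r),s)\rhd\tau(t,\tau(r,s))$. -}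

module Defs where

open import Data.Nat using (ℕ; zero; suc)
open import Data.Integer using (ℤ; +_; -[1+_])

-- Computational paths in S¹. Since S¹ has the single point base, every
-- path term built from loop, ρ, σ, τ is a path base = base.
data Path : Set where
  loop : Path
  ρ    : Path
  σ    : Path → Path
  τ    : Path → Path → Path

_∘ₚ_ : Path → Path → Path
r ∘ₚ s = τ s r

data _▷_ : Path → Path → Set where
  tr   : ∀ r → τ r (σ r) ▷ ρ
  tsr  : ∀ r → τ (σ r) r ▷ ρ
  trr  : ∀ r → τ r ρ ▷ r
  tlr  : ∀ r → τ ρ r ▷ r
  tt   : ∀ t r s → τ (τ t r) s ▷ τ t (τ r s)
  ss   : ∀ r → σ (σ r) ▷ r
  sr   : σ ρ ▷ ρ
  sσ   : ∀ {r r'} → r ▷ r' → σ r ▷ σ r'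
  sτˡ  : ∀ {r r'} s → r ▷ r' → τ r s ▷ τ r' s
  sτʳ  : ∀ r {s s'} → s ▷ s' → τ r s ▷ τ r s'

data _≈rw_ : Path → Path → Set where
  step  : ∀ {r s} → r ▷ s → r ≈rw s
  rfl   : ∀ {r} → r ≈rw r
  sym   : ∀ {r s} → r ≈rw s → s ≈rw r
  trns  : ∀ {r s t} → r ≈rw s → s ≈rw t → r ≈rw t

loopNeg : ℕ → Path
loopNeg zero    = ρ
loopNeg (suc n) = loopNeg n ∘ₚ σ loop

loopPos : ℕ → Path
loopPos zero    = ρ
loopPos (suc n) = loopPos n ∘ₚ loop

loop^ : ℤ → Path
loop^ (+ n)     = loopPos n
loop^ -[1+ n ]  = loopNeg (suc n)

-- A path is sent to its winding number, the signed count of its loops.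
-- Every rewrite rule is an identity of the additive group ℤ, so the
-- winding number is an rw-invariant. Conversely loop^ turns + into τ and
-- negation into σ up to rw, so rebuilding a path from its winding number
-- by structural recursion recovers it up to rw.
module Submission where

open import Defs
open import Data.Nat using (zero; suc)
open import Data.Integer using (ℤ; +_; -[1+_]; _+_; -_; 0ℤ; 1ℤ; -1ℤ)
open import Data.Integer.Properties
  using (+-assoc; +-identityˡ; +-identityʳ; +-inverseˡ; +-inverseʳ; neg-involutive)
open import Data.Product using (Σ; _×_; _,_)
open import Relation.Binary.Bundles using (Setoid)
open import Relation.Binary.PropositionalEquality as ≡ using (_≡_; refl; cong)

winding : Path → ℤ
winding loop    = 1ℤ
winding ρ       = 0ℤ
winding (σ r)   = - winding r
winding (τ r s) = winding r + winding s

winding-respects-▷ : ∀ {r s} → r ▷ s → winding r ≡ winding s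
winding-respects-▷ (tr r)     = +-inverseʳ (winding r)
winding-respects-▷ (tsr r)    = +-inverseˡ (winding r)
winding-respects-▷ (trr r)    = +-identityʳ (winding r)
winding-respects-▷ (tlr r)    = +-identityˡ (winding r)
winding-respects-▷ (tt t r s) = +-assoc (winding t) (winding r) (winding s)
winding-respects-▷ (ss r)     = neg-involutive (winding r)
winding-respects-▷ sr         = refl
winding-respects-▷ (sσ p)     = cong -_ (winding-respects-▷ p)
winding-respects-▷ (sτˡ s p)  = cong (_+ winding s) (winding-respects-▷ p)
winding-respects-▷ (sτʳ r p)  = cong (λ x → winding r + x) (winding-respects-▷ p)

winding-respects-≈rw : ∀ {r s} → r ≈rw s → winding r ≡ winding s
winding-respects-≈rw (step p)   = winding-respects-▷ p
winding-respects-≈rw rfl        = refl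
winding-respects-≈rw (sym p)    = ≡.sym (winding-respects-≈rw p)
winding-respects-≈rw (trns p q) = ≡.trans (winding-respects-≈rw p) (winding-respects-≈rw q)

winding-loopPos : ∀ n → winding (loopPos n) ≡ + n
winding-loopPos zero    = refl
winding-loopPos (suc n) = cong (λ x → 1ℤ + x) (winding-loopPos n)

winding-loopNeg : ∀ n → winding (loopNeg n) ≡ - + n
winding-loopNeg zero          = refl
winding-loopNeg (suc zero)    = refl
winding-loopNeg (suc (suc n)) = cong (λ x → -1ℤ + x) (winding-loopNeg (suc n))

winding-loop^ : ∀ n → winding (loop^ n) ≡ n
winding-loop^ (+ n)    = winding-loopPos n
winding-loop^ -[1+ n ] = winding-loopNeg (suc n)

≈rw-setoid : Setoid _ _
≈rw-setoid = record
  { Carrier       = Path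
  ; _≈_           = _≈rw_
  ; isEquivalence = record { refl = rfl ; sym = sym ; trans = trns }
  }

open import Relation.Binary.Reasoning.Setoid ≈rw-setoid

σ-cong : ∀ {r s} → r ≈rw s → σ r ≈rw σ s
σ-cong (step p)   = step (sσ p)
σ-cong rfl        = rfl
σ-cong (sym p)    = sym (σ-cong p)
σ-cong (trns p q) = trns (σ-cong p) (σ-cong q)

τ-congˡ : ∀ {r r'} s → r ≈rw r' → τ r s ≈rw τ r' s
τ-congˡ s (step p)   = step (sτˡ s p)
τ-congˡ s rfl        = rfl
τ-congˡ s (sym p)    = sym (τ-congˡ s p)
τ-congˡ s (trns p q) = trns (τ-congˡ s p) (τ-congˡ s q)

τ-congʳ : ∀ r {s s'} → s ≈rw s' → τ r s ≈rw τ r s'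
τ-congʳ r (step p)   = step (sτʳ r p)
τ-congʳ r rfl        = rfl
τ-congʳ r (sym p)    = sym (τ-congʳ r p)
τ-congʳ r (trns p q) = trns (τ-congʳ r p) (τ-congʳ r q)

τ-cong : ∀ {r r' s s'} → r ≈rw r' → s ≈rw s' → τ r s ≈rw τ r' s'
τ-cong {r' = r'} {s = s} p q = trns (τ-congˡ s p) (τ-congʳ r' q)

τ-cancelˡ : ∀ a b → τ a (τ (σ a) b) ≈rw b
τ-cancelˡ a b = begin
  τ a (τ (σ a) b)   ≈⟨ step (tt a (σ a) b) ⟨
  τ (τ a (σ a)) b   ≈⟨ τ-congˡ b (step (tr a)) ⟩
  τ ρ b             ≈⟨ step (tlr b) ⟩
  b                 ∎

τ-σ-cancelˡ : ∀ a b → τ (σ a) (τ a b) ≈rw b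
τ-σ-cancelˡ a b = begin
  τ (σ a) (τ a b)   ≈⟨ step (tt (σ a) a b) ⟨
  τ (τ (σ a) a) b   ≈⟨ τ-congˡ b (step (tsr a)) ⟩
  τ ρ b             ≈⟨ step (tlr b) ⟩
  b                 ∎

τ-inverseʳ-unique : ∀ a b → τ a b ≈rw ρ → b ≈rw σ a
τ-inverseʳ-unique a b ab≈ρ = begin
  b                 ≈⟨ τ-σ-cancelˡ a b ⟨
  τ (σ a) (τ a b)   ≈⟨ τ-congʳ (σ a) ab≈ρ ⟩
  τ (σ a) ρ         ≈⟨ step (trr (σ a)) ⟩
  σ a               ∎

-- loop^ -[1+ 0 ] is τ (σ loop) ρ rather than σ loop, hence the special cases.
loop^-suc : ∀ z → loop^ (1ℤ + z) ≈rw τ loop (loop^ z)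
loop^-suc (+ n)            = rfl
loop^-suc -[1+ zero ]      = sym (τ-cancelˡ loop ρ)
loop^-suc -[1+ suc n ]     = sym (τ-cancelˡ loop (loopNeg (suc n)))

loop^-pred : ∀ z → loop^ (-1ℤ + z) ≈rw τ (σ loop) (loop^ z)
loop^-pred -[1+ n ]        = rfl
loop^-pred (+ zero)        = rfl
loop^-pred (+ suc n)       = sym (τ-σ-cancelˡ loop (loopPos n))

loop^-+ : ∀ m n → loop^ (m + n) ≈rw τ (loop^ m) (loop^ n)
loop^-+ (+ zero) n = begin
  loop^ (0ℤ + n)             ≡⟨ cong loop^ (+-identityˡ n) ⟩
  loop^ n                    ≈⟨ step (tlr (loop^ n)) ⟨
  τ ρ (loop^ n)              ∎
loop^-+ (+ suc k) n = begin
  loop^ (1ℤ + + k + n)       ≡⟨ cong loop^ (+-assoc 1ℤ (+ k) n) ⟩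
  loop^ (1ℤ + (+ k + n))     ≈⟨ loop^-suc (+ k + n) ⟩
  τ loop (loop^ (+ k + n))   ≈⟨ τ-congʳ loop (loop^-+ (+ k) n) ⟩
  τ loop (τ (loopPos k) (loop^ n))
                             ≈⟨ step (tt loop (loopPos k) (loop^ n)) ⟨
  τ (τ loop (loopPos k)) (loop^ n) ∎
loop^-+ -[1+ zero ] n = begin
  loop^ (-1ℤ + n)            ≈⟨ loop^-pred n ⟩
  τ (σ loop) (loop^ n)       ≈⟨ τ-congˡ (loop^ n) (step (trr (σ loop))) ⟨
  τ (τ (σ loop) ρ) (loop^ n) ∎
loop^-+ -[1+ suc k ] n = begin
  loop^ (-1ℤ + -[1+ k ] + n)     ≡⟨ cong loop^ (+-assoc -1ℤ -[1+ k ] n) ⟩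
  loop^ (-1ℤ + (-[1+ k ] + n))   ≈⟨ loop^-pred (-[1+ k ] + n) ⟩
  τ (σ loop) (loop^ (-[1+ k ] + n))
                                 ≈⟨ τ-congʳ (σ loop) (loop^-+ -[1+ k ] n) ⟩
  τ (σ loop) (τ (loopNeg (suc k)) (loop^ n))
                                 ≈⟨ step (tt (σ loop) (loopNeg (suc k)) (loop^ n)) ⟨
  τ (τ (σ loop) (loopNeg (suc k))) (loop^ n) ∎

loop^-neg : ∀ z → loop^ (- z) ≈rw σ (loop^ z)
loop^-neg z = τ-inverseʳ-unique (loop^ z) (loop^ (- z)) (begin
  τ (loop^ z) (loop^ (- z))  ≈⟨ loop^-+ z (- z) ⟨
  loop^ (z + - z)            ≡⟨ cong loop^ (+-inverseʳ z) ⟩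
  ρ                          ∎)

loop^-winding : ∀ r → loop^ (winding r) ≈rw r
loop^-winding loop    = step (trr loop)
loop^-winding ρ       = rfl
loop^-winding (σ r)   = trns (loop^-neg (winding r)) (σ-cong (loop^-winding r))
loop^-winding (τ r s) =
  trns (loop^-+ (winding r) (winding s)) (τ-cong (loop^-winding r) (loop^-winding s))

theorem4 : Σ (Path → ℤ) λ f →
             (∀ r s → r ≈rw s → f r ≡ f s)
           × (∀ n → f (loop^ n) ≡ n)
           × (∀ r → loop^ (f r) ≈rw r)
theorem4 = winding , (λ _ _ → winding-respects-≈rw) , winding-loop^ , loop^-winding
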